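{- Neither $\mathbf{MRDP}^w$ nor $\mathbf{MRDP}$ can be proved in $\mathbf{BA}$, $\mathbf{BA}+\mathbf{U}$ or $\mathbf{BA}_c$.
   Context: $\mathbf{BA}$ (Basic Arithmetic) is the arithmetical theory in the language $\{0,S,+,\cdot\}$ based on Basic Predicate Calculus $\mathbf{BQC}$ (a sequent-style logic weaker than intuitionistic logic, in which modus ponens is weakened, so $A\Rightarrow B$ denotes a sequent while $A\rightarrow B$ is a formula). Its non-logical axioms are $Sx=0\Rightarrow\bot$, $Sx=Sy\Rightarrow x=y$, $x+0=x$, $x+Sy=S(x+y)$, $x\cdot 0=0$, $x\cdot Sy=x\cdot y+x$, the induction axiom schema $\forall \mathbf{y}x\,(A\rightarrow A[x/Sx])\Rightarrow\forall\mathbf{y}x\,(A[x/0]\rightarrow A)$, and the induction rule: from $A\Rightarrow A[x/Sx]$ infer $A[x/0]\Rightarrow A$. Here $s<t$ abbreviates $\exists x(s+Sx=t)$ and $s\le t$ abbreviates $s<t\lor s=t$. $\mathbf{U}$ is the axiom $x+z=y+z\Rightarrow x=y$. $\mathbf{BA}_c$ is the theory in the language $\{0,S,+,\cdot,\dot{ - }\}$ consisting of $\mathbf{BQC}$ for formulas of this language, the non-logical axioms of $\mathbf{BA}$, the induction rule and induction axiom schema for formulas of the extended language, and the axioms $x\le y\Rightarrow x\dot{ - }y=0$ and $y\le x\Rightarrow Sx\dot{ - }y=S(x\dot{ - }y)$ (so $\dot{ - }$ is intended as the cut-off subtraction). A $\Sigma_1$ formula is one of the form $\exists\mathbf{x}\,A$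 with $A$ a bounded ($\Delta_0$) formula; a positive existential ($\exists_1^+$) formula is one of the form $\exists\mathbf{x}\,A$ with $A$ quantifier-free and containing no implications (built from atomic formulas with $\land,\lor$). For a theory $\mathbf{T}$: $\mathbf{T}\vdash\mathbf{MRDP}$ means that for every $\Sigma_1$ formula $A$ there is an $\exists_1^+$ formula $B$ with the same free variables such that $\mathbf{T}$ proves both sequents $A\Rightarrow B$ and $B\Rightarrow A$; $\mathbf{T}\vdash\mathbf{MRDP}^w$ means that for every $\Sigma_1$ formula $A$ there is an $\exists_1^+$ formula $B$ with the same free variables such that $\mathbf{T}$ proves the formula $A\leftrightarrow B$ (i.e. $(A\rightarrow B)\land(B\rightarrow A)$). -}

module Defs where

open import Data.Bool using (Bool; true; false)
open import Data.Nat using (ℕ; zero; suc; _+_)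
open import Data.Fin using (Fin; zero; suc; _↑ˡ_; _↑ʳ_; splitAt)
open import Data.Sum using (_⊎_; inj₁; inj₂; [_,_])
open import Data.Product using (Σ; _×_; _,_)

-- The Bool index says whether
-- the cut-off subtraction symbol ∸ is in the language (true = language
-- {0,S,+,·,∸} of BA_c, false = language {0,S,+,·} of BA).

data Term : Bool → ℕ → Set where
  var   : ∀ {b n} → Fin n → Term b n
  `0    : ∀ {b n} → Term b n
  `S    : ∀ {b n} → Term b n → Term b n
  _`+_  : ∀ {b n} → Term b n → Term b n → Term b n
  _`·_  : ∀ {b n} → Term b n → Term b n → Term b n
  _`∸_  : ∀ {n} → Term true n → Term true n → Term true n

infixl 6 _`+_ _`∸_
infixl 7 _`·_

-- Formulas of basic logic: atoms s = t, ⊤, ⊥, ∧, ∨, ∃x A, and the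
-- restricted universal  ∀ x₁…x_k (A → B)  binding k variables
-- (the bound variables are var 0 .. var (k-1)).  A → B is the case k = 0.
data Formula : Bool → ℕ → Set where
  _≐_  : ∀ {b n} → Term b n → Term b n → Formula b n
  ⊤'   : ∀ {b n} → Formula b n
  ⊥'   : ∀ {b n} → Formula b n
  _∧'_ : ∀ {b n} → Formula b n → Formula b n → Formula b n
  _∨'_ : ∀ {b n} → Formula b n → Formula b n → Formula b n
  ∃'   : ∀ {b n} → Formula b (suc n) → Formula b n
  ∀'   : ∀ {b n} (k : ℕ) → Formula b (k + n) → Formula b (k + n) → Formula b n

infix 4 _≐_
infixr 3 _∧'_
infixr 2 _∨'_

_⇛_ : ∀ {b n} → Formula b n → Formula b n → Formula b n
A ⇛ B = ∀' 0 A B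

infixr 1 _⇛_

_⇔'_ : ∀ {b n} → Formula b n → Formula b n → Formula b n
A ⇔' B = (A ⇛ B) ∧' (B ⇛ A)

renT : ∀ {b m n} → (Fin m → Fin n) → Term b m → Term b n
renT ρ (var i)  = var (ρ i)
renT ρ `0       = `0
renT ρ (`S t)   = `S (renT ρ t)
renT ρ (s `+ t) = renT ρ s `+ renT ρ t
renT ρ (s `· t) = renT ρ s `· renT ρ t
renT ρ (s `∸ t) = renT ρ s `∸ renT ρ t

Sub : Bool → ℕ → ℕ → Set
Sub b m n = Fin m → Term b n

subT : ∀ {b m n} → Sub b m n → Term b m → Term b n
subT σ (var i)  = σ i
subT σ `0       = `0
subT σ (`S t)   = `S (subT σ t)
subT σ (s `+ t) = subT σ s `+ subT σ t
subT σ (s `· t) = subT σ s `· subT σ t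
subT σ (s `∸ t) = subT σ s `∸ subT σ t

lift : ∀ {b m n} (k : ℕ) → Sub b m n → Sub b (k + m) (k + n)
lift {n = n} k σ i =
  [ (λ j → var (j ↑ˡ n)) , (λ j → renT (k ↑ʳ_) (σ j)) ] (splitAt k i)

sub : ∀ {b m n} → Sub b m n → Formula b m → Formula b n
sub σ (s ≐ t)    = subT σ s ≐ subT σ t
sub σ ⊤'         = ⊤'
sub σ ⊥'         = ⊥'
sub σ (A ∧' B)   = sub σ A ∧' sub σ B
sub σ (A ∨' B)   = sub σ A ∨' sub σ B
sub σ (∃' A)     = ∃' (sub (lift 1 σ) A)
sub σ (∀' k A B) = ∀' k (sub (lift k σ) A) (sub (lift k σ) B)

-- weakening by k fresh variables (placed at positions 0..k-1)
wkT : ∀ {b n} (k : ℕ) → Term b n → Term b (k + n)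
wkT k = renT (k ↑ʳ_)

wk : ∀ {b n} (k : ℕ) → Formula b n → Formula b (k + n)
wk k = sub (λ i → var (k ↑ʳ i))

σ₀ : ∀ {b n} → Term b n → Sub b (suc n) n
σ₀ t zero    = t
σ₀ t (suc i) = var i

_[_]₀ : ∀ {b n} → Formula b (suc n) → Term b n → Formula b n
A [ t ]₀ = sub (σ₀ t) A

σS : ∀ {b n} → Sub b (suc n) (suc n)
σS zero    = `S (var zero)
σS (suc i) = var (suc i)

-- A[x/0] where x is variable 0, keeping the context (x becomes vacuous)
σZ : ∀ {b n} → Sub b (suc n) (suc n)
σZ zero    = `0
σZ (suc i) = var (suc i)

-- substitution used in the instantiation axiom for ∀:
-- the k bound variables are replaced by terms over m new bound
-- variables and the context; context variables are kept.
inst : ∀ {b n} (k m : ℕ) → (Fin k → Term b (m + n)) → Sub b (k + n) (m + n)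
inst k m σ i = [ σ , (λ j → var (m ↑ʳ j)) ] (splitAt k i)

_<'_ : ∀ {b n} → Term b n → Term b n → Formula b n
s <' t = ∃' (wkT 1 s `+ `S (var zero) ≐ wkT 1 t)

_≤'_ : ∀ {b n} → Term b n → Term b n → Formula b n
s ≤' t = (s <' t) ∨' (s ≐ t)

-- Basic Predicate Calculus BQC (Ruitenburg / Ardeshir), as sequents
-- A ⇒ B in context n, extended by the non-logical part of an
-- arithmetical theory: the axioms of BA, the induction axiom schema
-- and the induction rule (for all formulas of the language), plus the
-- extra axioms of the theory.

record Theory : Set₁ where
  field
    lang  : Bool
    Extra : ∀ {n} → Formula lang n → Formula lang n → Set

open Theory public

x₀ : ∀ {b n} → Term b (suc n)
x₀ = var zero
x₁ : ∀ {b n} → Term b (suc (suc n))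
x₁ = var (suc zero)
x₂ : ∀ {b n} → Term b (suc (suc (suc n)))
x₂ = var (suc (suc zero))

data BAAxiom (b : Bool) : ∀ {n} → Formula b n → Formula b n → Set where
  succ≠0   : BAAxiom b {2} (`S x₀ ≐ `0) ⊥'
  succInj  : BAAxiom b {2} (`S x₀ ≐ `S x₁) (x₀ ≐ x₁)
  plus0    : BAAxiom b {2} ⊤' (x₀ `+ `0 ≐ x₀)
  plusS    : BAAxiom b {2} ⊤' (x₀ `+ `S x₁ ≐ `S (x₀ `+ x₁))
  times0   : BAAxiom b {2} ⊤' (x₀ `· `0 ≐ `0)
  timesS   : BAAxiom b {2} ⊤' (x₀ `· `S x₁ ≐ x₀ `· x₁ `+ x₀)
  -- ∀y x (A → A[x/Sx]) ⇒ ∀y x (A[x/0] → A), where A has free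
  -- variables among x (= var 0) and y (= var 1 .. var n)
  induction : ∀ {n} (A : Formula b (suc n)) →
    let close : Formula b (suc n) → Formula b (suc n + 0)
        close = sub (λ i → var (i ↑ˡ 0)) in
    BAAxiom b {0} (∀' (suc n) (close A) (close (sub σS A)))
                  (∀' (suc n) (close (sub σZ A)) (close A))

infix 1 _⊢_⇒_

data _⊢_⇒_ (T : Theory) : ∀ {n} → Formula (lang T) n → Formula (lang T) n → Set where
  refl⇒   : ∀ {n} {A : Formula (lang T) n} → T ⊢ A ⇒ A
  top     : ∀ {n} {A : Formula (lang T) n} → T ⊢ A ⇒ ⊤'
  bot     : ∀ {n} {A : Formula (lang T) n} → T ⊢ ⊥' ⇒ A
  ∧-el₁   : ∀ {n} {A B : Formula (lang T) n} → T ⊢ A ∧' B ⇒ A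
  ∧-el₂   : ∀ {n} {A B : Formula (lang T) n} → T ⊢ A ∧' B ⇒ B
  ∨-in₁   : ∀ {n} {A B : Formula (lang T) n} → T ⊢ A ⇒ A ∨' B
  ∨-in₂   : ∀ {n} {A B : Formula (lang T) n} → T ⊢ B ⇒ A ∨' B
  distr   : ∀ {n} {A B C : Formula (lang T) n} →
            T ⊢ A ∧' (B ∨' C) ⇒ (A ∧' B) ∨' (A ∧' C)
  ∃-distr : ∀ {n} {A : Formula (lang T) n} {B : Formula (lang T) (suc n)} →
            T ⊢ A ∧' ∃' B ⇒ ∃' (wk 1 A ∧' B)
  ∃-in    : ∀ {n} {A : Formula (lang T) (suc n)} {t : Term (lang T) n} →
            T ⊢ A [ t ]₀ ⇒ ∃' A
  ∀-trans : ∀ {n k} {A B C : Formula (lang T) (k + n)} →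
            T ⊢ ∀' k A B ∧' ∀' k B C ⇒ ∀' k A C
  ∀-∧     : ∀ {n k} {A B C : Formula (lang T) (k + n)} →
            T ⊢ ∀' k A B ∧' ∀' k A C ⇒ ∀' k A (B ∧' C)
  ∀-∨     : ∀ {n k} {A B C : Formula (lang T) (k + n)} →
            T ⊢ ∀' k B A ∧' ∀' k C A ⇒ ∀' k (B ∨' C) A
  ∀-∃     : ∀ {n k} {A : Formula (lang T) (k + n)} {B : Formula (lang T) (suc (k + n))} →
            T ⊢ ∀' (suc k) B (wk 1 A) ⇒ ∀' k (∃' B) A
  ∀-inst  : ∀ {n k m} {A B : Formula (lang T) (k + n)}
              (σ : Fin k → Term (lang T) (m + n)) →
            T ⊢ ∀' k A B ⇒ ∀' m (sub (inst k m σ) A) (sub (inst k m σ) B)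
  eq-refl : ∀ {n} {t : Term (lang T) n} → T ⊢ ⊤' ⇒ t ≐ t
  eq-subst : ∀ {n} {s t : Term (lang T) n} {u v : Term (lang T) (suc n)} →
            T ⊢ (s ≐ t) ∧' (subT (σ₀ s) u ≐ subT (σ₀ s) v)
              ⇒ (subT (σ₀ t) u ≐ subT (σ₀ t) v)
  cut     : ∀ {n} {A B C : Formula (lang T) n} →
            T ⊢ A ⇒ B → T ⊢ B ⇒ C → T ⊢ A ⇒ C
  ∧-in    : ∀ {n} {A B C : Formula (lang T) n} →
            T ⊢ A ⇒ B → T ⊢ A ⇒ C → T ⊢ A ⇒ B ∧' C
  ∨-el    : ∀ {n} {A B C : Formula (lang T) n} →
            T ⊢ A ⇒ C → T ⊢ B ⇒ C → T ⊢ A ∨' B ⇒ C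
  ∃-el    : ∀ {n} {A : Formula (lang T) (suc n)} {B : Formula (lang T) n} →
            T ⊢ A ⇒ wk 1 B → T ⊢ ∃' A ⇒ B
  ∀-in    : ∀ {n k} {A : Formula (lang T) n} {B C : Formula (lang T) (k + n)} →
            T ⊢ wk k A ∧' B ⇒ C → T ⊢ A ⇒ ∀' k B C
  subst-rule : ∀ {m n} {A B : Formula (lang T) m} (σ : Sub (lang T) m n) →
            T ⊢ A ⇒ B → T ⊢ sub σ A ⇒ sub σ B
  ba-ax   : ∀ {n} {A B : Formula (lang T) n} → BAAxiom (lang T) A B → T ⊢ A ⇒ B
  ind-rule : ∀ {n} {A : Formula (lang T) (suc n)} →
            T ⊢ A ⇒ sub σS A → T ⊢ sub σZ A ⇒ A
  extra   : ∀ {n} {A B : Formula (lang T) n} → Extra T A B → T ⊢ A ⇒ B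

data NoExtra {n : ℕ} : Formula false n → Formula false n → Set where

data UAxiom : ∀ {n} → Formula false n → Formula false n → Set where
  U : UAxiom {3} (x₀ `+ x₂ ≐ x₁ `+ x₂) (x₀ ≐ x₁)

data MonusAxiom : ∀ {n} → Formula true n → Formula true n → Set where
  monus₁ : MonusAxiom {2} (x₀ ≤' x₁) (x₀ `∸ x₁ ≐ `0)
  monus₂ : MonusAxiom {2} (x₁ ≤' x₀) (`S x₀ `∸ x₁ ≐ `S (x₀ `∸ x₁))

BA : Theory
BA = record { lang = false ; Extra = NoExtra }

BA+U : Theory
BA+U = record { lang = false ; Extra = UAxiom }

BAc : Theory
BAc = record { lang = true ; Extra = MonusAxiom }

data Δ₀ {b : Bool} : ∀ {n} → Formula b n → Set where
  atom : ∀ {n} (s t : Term b n) → Δ₀ (s ≐ t)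
  top  : ∀ {n} → Δ₀ {n = n} ⊤'
  bot  : ∀ {n} → Δ₀ {n = n} ⊥'
  and  : ∀ {n} {A B : Formula b n} → Δ₀ A → Δ₀ B → Δ₀ (A ∧' B)
  or   : ∀ {n} {A B : Formula b n} → Δ₀ A → Δ₀ B → Δ₀ (A ∨' B)
  imp  : ∀ {n} {A B : Formula b n} → Δ₀ A → Δ₀ B → Δ₀ (A ⇛ B)
  bex  : ∀ {n} (t : Term b n) {A : Formula b (suc n)} → Δ₀ A →
         Δ₀ (∃' ((var zero <' wkT 1 t) ∧' A))
  ball : ∀ {n} (t : Term b n) {A : Formula b (suc n)} → Δ₀ A →
         Δ₀ (∀' 1 (var zero <' wkT 1 t) A)

data Σ₁ {b : Bool} : ∀ {n} → Formula b n → Set where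
  bounded : ∀ {n} {A : Formula b n} → Δ₀ A → Σ₁ A
  ex      : ∀ {n} {A : Formula b (suc n)} → Σ₁ A → Σ₁ (∃' A)

data Positive {b : Bool} : ∀ {n} → Formula b n → Set where
  atom : ∀ {n} (s t : Term b n) → Positive (s ≐ t)
  top  : ∀ {n} → Positive {n = n} ⊤'
  bot  : ∀ {n} → Positive {n = n} ⊥'
  and  : ∀ {n} {A B : Formula b n} → Positive A → Positive B → Positive (A ∧' B)
  or   : ∀ {n} {A B : Formula b n} → Positive A → Positive B → Positive (A ∨' B)

data PosEx {b : Bool} : ∀ {n} → Formula b n → Set where
  matrix : ∀ {n} {A : Formula b n} → Positive A → PosEx A
  ex     : ∀ {n} {A : Formula b (suc n)} → PosEx A → PosEx (∃' A)

MRDP : Theory → Set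
MRDP T = ∀ {n} (A : Formula (lang T) n) → Σ₁ A →
  Σ (Formula (lang T) n) λ B → PosEx B × (T ⊢ A ⇒ B) × (T ⊢ B ⇒ A)

MRDPʷ : Theory → Set
MRDPʷ T = ∀ {n} (A : Formula (lang T) n) → Σ₁ A →
  Σ (Formula (lang T) n) λ B → PosEx B × (T ⊢ ⊤' ⇒ ((A ⇛ B) ∧' (B ⇛ A)))

{-# OPTIONS --safe #-}
module Submission where

open import Defs
open import Data.Product using (_×_)
open import Relation.Nullary using (¬_)

open import Data.Nat using (ℕ; zero; suc; _+_; _*_; _∸_; _≤_; _<_; z≤n; s≤s)
open import Data.Nat.Properties
open import Data.Fin using (Fin; zero; suc; _↑ˡ_; _↑ʳ_; splitAt)
open import Data.Fin.Properties using (splitAt-↑ˡ; splitAt-↑ʳ)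
open import Data.Sum using (_⊎_; inj₁; inj₂; [_,_])
open import Data.Product using (Σ; _,_)
open import Data.Unit using (⊤; tt)
open import Data.Empty using (⊥)
open import Relation.Binary.PropositionalEquality
  using (_≡_; _≗_; refl; sym; trans; cong; cong₂; subst; module ≡-Reasoning)

-- Every theory in question is sound for the Kripke model whose nodes are the
-- natural numbers, node w seeing exactly the nodes j < w, with the standard
-- model ℕ at every node.  The order is irreflexive, as basic logic allows:
-- node 0 sees nothing, so the Δ₀ sentence ¬ 0 = 0 holds there, while it fails
-- at node 1.  A positive existential sentence has the same truth value at
-- every node, so no such sentence can be equivalent to ¬ 0 = 0, even in the
-- weak sense of MRDPʷ (which only needs the nodes 0 < 1 < 2).

Env : ℕ → Set
Env n = Fin n → ℕ

evalT : ∀ {b n} → Env n → Term b n → ℕ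
evalT ρ (var i)  = ρ i
evalT ρ `0       = 0
evalT ρ (`S t)   = suc (evalT ρ t)
evalT ρ (s `+ t) = evalT ρ s + evalT ρ t
evalT ρ (s `· t) = evalT ρ s * evalT ρ t
evalT ρ (s `∸ t) = evalT ρ s ∸ evalT ρ t

ext : ∀ {k n} → (Fin k → ℕ) → Env n → Env (k + n)
ext {k} vs ρ i = [ vs , ρ ] (splitAt k i)

ext₁ : ∀ {n} → ℕ → Env n → Env (suc n)
ext₁ v = ext {1} (λ _ → v)

cons : ∀ {n} → ℕ → Env n → Env (suc n)
cons v ρ zero    = v
cons v ρ (suc i) = ρ i

Sat : ∀ {b n} → Formula b n → ℕ → Env n → Set
Sat (s ≐ t)    w ρ = evalT ρ s ≡ evalT ρ t
Sat ⊤'         w ρ = ⊤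
Sat ⊥'         w ρ = ⊥
Sat (A ∧' B)   w ρ = Sat A w ρ × Sat B w ρ
Sat (A ∨' B)   w ρ = Sat A w ρ ⊎ Sat B w ρ
Sat (∃' A)     w ρ = Σ ℕ λ v → Sat A w (ext₁ v ρ)
Sat (∀' k A B) w ρ =
  ∀ j → j < w → (vs : Fin k → ℕ) → Sat A j (ext vs ρ) → Sat B j (ext vs ρ)

evalT-cong : ∀ {b n} {ρ ρ′ : Env n} → ρ ≗ ρ′ → (t : Term b n) → evalT ρ t ≡ evalT ρ′ t
evalT-cong e (var i)  = e i
evalT-cong e `0       = refl
evalT-cong e (`S t)   = cong suc (evalT-cong e t)
evalT-cong e (s `+ t) = cong₂ _+_ (evalT-cong e s) (evalT-cong e t)
evalT-cong e (s `· t) = cong₂ _*_ (evalT-cong e s) (evalT-cong e t)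
evalT-cong e (s `∸ t) = cong₂ _∸_ (evalT-cong e s) (evalT-cong e t)

evalT-renT : ∀ {b m n} (ρ : Env n) (f : Fin m → Fin n) (t : Term b m) →
             evalT ρ (renT f t) ≡ evalT (λ i → ρ (f i)) t
evalT-renT ρ f (var i)  = refl
evalT-renT ρ f `0       = refl
evalT-renT ρ f (`S t)   = cong suc (evalT-renT ρ f t)
evalT-renT ρ f (s `+ t) = cong₂ _+_ (evalT-renT ρ f s) (evalT-renT ρ f t)
evalT-renT ρ f (s `· t) = cong₂ _*_ (evalT-renT ρ f s) (evalT-renT ρ f t)
evalT-renT ρ f (s `∸ t) = cong₂ _∸_ (evalT-renT ρ f s) (evalT-renT ρ f t)

evalT-subT : ∀ {b m n} (ρ : Env n) (σ : Sub b m n) (t : Term b m) →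
             evalT ρ (subT σ t) ≡ evalT (λ i → evalT ρ (σ i)) t
evalT-subT ρ σ (var i)  = refl
evalT-subT ρ σ `0       = refl
evalT-subT ρ σ (`S t)   = cong suc (evalT-subT ρ σ t)
evalT-subT ρ σ (s `+ t) = cong₂ _+_ (evalT-subT ρ σ s) (evalT-subT ρ σ t)
evalT-subT ρ σ (s `· t) = cong₂ _*_ (evalT-subT ρ σ s) (evalT-subT ρ σ t)
evalT-subT ρ σ (s `∸ t) = cong₂ _∸_ (evalT-subT ρ σ s) (evalT-subT ρ σ t)

ext-↑ˡ : ∀ {k n} (vs : Fin k → ℕ) (ρ : Env n) (i : Fin k) → ext vs ρ (i ↑ˡ n) ≡ vs i
ext-↑ˡ {k} {n} vs ρ i rewrite splitAt-↑ˡ k i n = refl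

ext-↑ʳ : ∀ {k n} (vs : Fin k → ℕ) (ρ : Env n) (i : Fin n) → ext vs ρ (k ↑ʳ i) ≡ ρ i
ext-↑ʳ {k} {n} vs ρ i rewrite splitAt-↑ʳ k n i = refl

ext-cong : ∀ {k n} (vs : Fin k → ℕ) {ρ ρ′ : Env n} → ρ ≗ ρ′ → ext vs ρ ≗ ext vs ρ′
ext-cong {k} vs e i with splitAt k i
... | inj₁ j = refl
... | inj₂ j = e j

ext₁-ext : ∀ {k n} (v : ℕ) (vs : Fin k → ℕ) (ρ : Env n) →
           ext₁ v (ext vs ρ) ≗ ext {suc k} (cons v vs) ρ
ext₁-ext v vs ρ zero = refl
ext₁-ext {k} v vs ρ (suc i) with splitAt k i
... | inj₁ j = refl
... | inj₂ j = refl

evalT-lift : ∀ {b m n} (k : ℕ) (σ : Sub b m n) (ρ : Env n) (vs : Fin k → ℕ) →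
             (λ i → evalT (ext vs ρ) (lift k σ i)) ≗ ext vs (λ i → evalT ρ (σ i))
evalT-lift k σ ρ vs i with splitAt k i
... | inj₁ j = ext-↑ˡ vs ρ j
... | inj₂ j = trans (evalT-renT (ext vs ρ) (k ↑ʳ_) (σ j)) (evalT-cong (ext-↑ʳ vs ρ) (σ j))

evalT-σ₀ : ∀ {b n} (ρ : Env n) (t : Term b n) → (λ i → evalT ρ (σ₀ t i)) ≗ ext₁ (evalT ρ t) ρ
evalT-σ₀ ρ t zero    = refl
evalT-σ₀ ρ t (suc i) = refl

evalT-inst : ∀ {b n} (k m : ℕ) (σ : Fin k → Term b (m + n)) (us : Fin m → ℕ) (ρ : Env n) →
             (λ i → evalT (ext us ρ) (inst k m σ i)) ≗ ext (λ i → evalT (ext us ρ) (σ i)) ρ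
evalT-inst k m σ us ρ i with splitAt k i
... | inj₁ j = refl
... | inj₂ j = ext-↑ʳ us ρ j

sat-cong : ∀ {b n} (A : Formula b n) {w} {ρ ρ′ : Env n} → ρ ≗ ρ′ → Sat A w ρ → Sat A w ρ′
sat-cong (s ≐ t)    e p = trans (sym (evalT-cong e s)) (trans p (evalT-cong e t))
sat-cong ⊤'         e p = p
sat-cong ⊥'         e p = p
sat-cong (A ∧' B)   e (p , q) = sat-cong A e p , sat-cong B e q
sat-cong (A ∨' B)   e (inj₁ p) = inj₁ (sat-cong A e p)
sat-cong (A ∨' B)   e (inj₂ q) = inj₂ (sat-cong B e q)
sat-cong (∃' A)     e (v , p) = v , sat-cong A (ext-cong _ e) p
sat-cong (∀' k A B) e h j j<w vs a =
  sat-cong B (ext-cong vs e) (h j j<w vs (sat-cong A (ext-cong vs (λ i → sym (e i))) a))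

-- Both directions at once, because ∀' k A B is contravariant in A.
mutual
  sat-sub⁻ : ∀ {b m n} (A : Formula b m) (σ : Sub b m n) {w} (ρ : Env n) →
             Sat (sub σ A) w ρ → Sat A w (λ i → evalT ρ (σ i))
  sat-sub⁻ (s ≐ t) σ ρ p = trans (sym (evalT-subT ρ σ s)) (trans p (evalT-subT ρ σ t))
  sat-sub⁻ ⊤' σ ρ p = p
  sat-sub⁻ ⊥' σ ρ p = p
  sat-sub⁻ (A ∧' B) σ ρ (p , q) = sat-sub⁻ A σ ρ p , sat-sub⁻ B σ ρ q
  sat-sub⁻ (A ∨' B) σ ρ (inj₁ p) = inj₁ (sat-sub⁻ A σ ρ p)
  sat-sub⁻ (A ∨' B) σ ρ (inj₂ q) = inj₂ (sat-sub⁻ B σ ρ q)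
  sat-sub⁻ (∃' A) σ ρ (v , p) =
    v , sat-cong A (evalT-lift 1 σ ρ _) (sat-sub⁻ A (lift 1 σ) (ext₁ v ρ) p)
  sat-sub⁻ (∀' k A B) σ ρ h j j<w vs a =
    sat-cong B (evalT-lift k σ ρ vs) (sat-sub⁻ B (lift k σ) (ext vs ρ) (h j j<w vs a′))
    where a′ = sat-sub⁺ A (lift k σ) (ext vs ρ) (sat-cong A (λ i → sym (evalT-lift k σ ρ vs i)) a)

  sat-sub⁺ : ∀ {b m n} (A : Formula b m) (σ : Sub b m n) {w} (ρ : Env n) →
             Sat A w (λ i → evalT ρ (σ i)) → Sat (sub σ A) w ρ
  sat-sub⁺ (s ≐ t) σ ρ p = trans (evalT-subT ρ σ s) (trans p (sym (evalT-subT ρ σ t)))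
  sat-sub⁺ ⊤' σ ρ p = p
  sat-sub⁺ ⊥' σ ρ p = p
  sat-sub⁺ (A ∧' B) σ ρ (p , q) = sat-sub⁺ A σ ρ p , sat-sub⁺ B σ ρ q
  sat-sub⁺ (A ∨' B) σ ρ (inj₁ p) = inj₁ (sat-sub⁺ A σ ρ p)
  sat-sub⁺ (A ∨' B) σ ρ (inj₂ q) = inj₂ (sat-sub⁺ B σ ρ q)
  sat-sub⁺ (∃' A) σ ρ (v , p) =
    v , sat-sub⁺ A (lift 1 σ) (ext₁ v ρ) (sat-cong A (λ i → sym (evalT-lift 1 σ ρ _ i)) p)
  sat-sub⁺ (∀' k A B) σ ρ h j j<w vs a =
    sat-sub⁺ B (lift k σ) (ext vs ρ)
      (sat-cong B (λ i → sym (evalT-lift k σ ρ vs i)) (h j j<w vs a′))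
    where a′ = sat-cong A (evalT-lift k σ ρ vs) (sat-sub⁻ A (lift k σ) (ext vs ρ) a)

sat-wk⁻ : ∀ {b n} (k : ℕ) (A : Formula b n) {w} (vs : Fin k → ℕ) (ρ : Env n) →
          Sat (wk k A) w (ext vs ρ) → Sat A w ρ
sat-wk⁻ k A vs ρ p = sat-cong A (ext-↑ʳ vs ρ) (sat-sub⁻ A (λ i → var (k ↑ʳ i)) (ext vs ρ) p)

sat-wk⁺ : ∀ {b n} (k : ℕ) (A : Formula b n) {w} (vs : Fin k → ℕ) (ρ : Env n) →
          Sat A w ρ → Sat (wk k A) w (ext vs ρ)
sat-wk⁺ k A vs ρ p =
  sat-sub⁺ A (λ i → var (k ↑ʳ i)) (ext vs ρ) (sat-cong A (λ i → sym (ext-↑ʳ vs ρ i)) p)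

sat-persistent : ∀ {b n} (A : Formula b n) {w j} {ρ : Env n} → j < w → Sat A w ρ → Sat A j ρ
sat-persistent (s ≐ t)    j<w p = p
sat-persistent ⊤'         j<w p = p
sat-persistent ⊥'         j<w p = p
sat-persistent (A ∧' B)   j<w (p , q) = sat-persistent A j<w p , sat-persistent B j<w q
sat-persistent (A ∨' B)   j<w (inj₁ p) = inj₁ (sat-persistent A j<w p)
sat-persistent (A ∨' B)   j<w (inj₂ q) = inj₂ (sat-persistent B j<w q)
sat-persistent (∃' A)     j<w (v , p) = v , sat-persistent A j<w p
sat-persistent (∀' k A B) j<w h i i<j = h i (<-trans i<j j<w)

sat-induction : ∀ {b n} (A : Formula b (suc n)) {w} →
                (∀ ρ → Sat A w ρ → Sat (sub σS A) w ρ) →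
                ∀ ρ → Sat (sub σZ A) w ρ → Sat A w ρ
sat-induction {n = n} A {w} step ρ base = sat-cong A ρ-eta (go (ρ zero))
  where
  tail : Env n
  tail i = ρ (suc i)
  ρ-eta : cons (ρ zero) tail ≗ ρ
  ρ-eta zero    = refl
  ρ-eta (suc i) = refl
  evalT-σZ : (λ i → evalT ρ (σZ {n = n} i)) ≗ cons 0 tail
  evalT-σZ zero    = refl
  evalT-σZ (suc i) = refl
  evalT-σS : ∀ x → (λ i → evalT (cons x tail) (σS {n = n} i)) ≗ cons (suc x) tail
  evalT-σS x zero    = refl
  evalT-σS x (suc i) = refl
  go : ∀ x → Sat A w (cons x tail)
  go zero    = sat-cong A evalT-σZ (sat-sub⁻ A σZ ρ base)
  go (suc x) = sat-cong A (evalT-σS x) (sat-sub⁻ A σS (cons x tail) (step (cons x tail) (go x)))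

Valid : ∀ {b n} → Formula b n → Formula b n → Set
Valid A B = ∀ w ρ → Sat A w ρ → Sat B w ρ

ExtraValid : Theory → Set
ExtraValid T = ∀ {n} {A B : Formula (lang T) n} → Extra T A B → Valid A B

baAxiom-valid : ∀ {b n} {A B : Formula b n} → BAAxiom b A B → Valid A B
baAxiom-valid succ≠0  w ρ ()
baAxiom-valid succInj w ρ p = suc-injective p
baAxiom-valid plus0   w ρ _ = +-identityʳ (ρ zero)
baAxiom-valid plusS   w ρ _ = +-suc (ρ zero) (ρ (suc zero))
baAxiom-valid times0  w ρ _ = *-zeroʳ (ρ zero)
baAxiom-valid timesS  w ρ _ = trans (*-suc (ρ zero) (ρ (suc zero))) (+-comm (ρ zero) _)
baAxiom-valid (induction {n} A) w ρ h j j<w vs a₀ =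
  close⁺ A (sat-induction A step vs (close⁻ (sub σZ A) a₀))
  where
  close⁻ : ∀ (X : Formula _ (suc n)) {us} → Sat (sub (λ i → var (i ↑ˡ 0)) X) j (ext us ρ) → Sat X j us
  close⁻ X {us} p = sat-cong X (ext-↑ˡ us ρ) (sat-sub⁻ X (λ i → var (i ↑ˡ 0)) (ext us ρ) p)
  close⁺ : ∀ (X : Formula _ (suc n)) {us} → Sat X j us → Sat (sub (λ i → var (i ↑ˡ 0)) X) j (ext us ρ)
  close⁺ X {us} p = sat-sub⁺ X (λ i → var (i ↑ˡ 0)) (ext us ρ) (sat-cong X (λ i → sym (ext-↑ˡ us ρ i)) p)
  step : ∀ us → Sat A j us → Sat (sub σS A) j us
  step us a = close⁻ (sub σS A) (h j j<w us (close⁺ A a))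

eq-subst-valid : ∀ {b n} (s t : Term b n) (u v : Term b (suc n)) (ρ : Env n) →
                 evalT ρ s ≡ evalT ρ t →
                 evalT ρ (subT (σ₀ s) u) ≡ evalT ρ (subT (σ₀ s) v) →
                 evalT ρ (subT (σ₀ t) u) ≡ evalT ρ (subT (σ₀ t) v)
eq-subst-valid s t u v ρ s≡t su≡sv = begin
  evalT ρ (subT (σ₀ t) u)  ≡⟨ evalT-subT ρ (σ₀ t) u ⟩
  evalT ρt u               ≡⟨ evalT-cong ρs≗ρt u ⟨
  evalT ρs u               ≡⟨ evalT-subT ρ (σ₀ s) u ⟨
  evalT ρ (subT (σ₀ s) u)  ≡⟨ su≡sv ⟩
  evalT ρ (subT (σ₀ s) v)  ≡⟨ evalT-subT ρ (σ₀ s) v ⟩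
  evalT ρs v               ≡⟨ evalT-cong ρs≗ρt v ⟩
  evalT ρt v               ≡⟨ evalT-subT ρ (σ₀ t) v ⟨
  evalT ρ (subT (σ₀ t) v)  ∎
  where
  open ≡-Reasoning
  ρs ρt : Env (suc _)
  ρs i = evalT ρ (σ₀ s i)
  ρt i = evalT ρ (σ₀ t i)
  ρs≗ρt : ρs ≗ ρt
  ρs≗ρt zero    = s≡t
  ρs≗ρt (suc i) = refl

soundness : ∀ {T} → ExtraValid T → ∀ {n} {A B : Formula (lang T) n} → T ⊢ A ⇒ B → Valid A B
soundness ok refl⇒ w ρ a = a
soundness ok top   w ρ a = tt
soundness ok bot   w ρ ()
soundness ok ∧-el₁ w ρ (a , b) = a
soundness ok ∧-el₂ w ρ (a , b) = b
soundness ok ∨-in₁ w ρ a = inj₁ a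
soundness ok ∨-in₂ w ρ b = inj₂ b
soundness ok distr w ρ (a , inj₁ b) = inj₁ (a , b)
soundness ok distr w ρ (a , inj₂ c) = inj₂ (a , c)
soundness ok (∃-distr {A = A}) w ρ (a , v , b) = v , sat-wk⁺ 1 A _ ρ a , b
soundness ok (∃-in {A = A} {t = t}) w ρ a =
  evalT ρ t , sat-cong A (evalT-σ₀ ρ t) (sat-sub⁻ A (σ₀ t) ρ a)
soundness ok ∀-trans w ρ (f , g) j j<w vs a = g j j<w vs (f j j<w vs a)
soundness ok ∀-∧     w ρ (f , g) j j<w vs a = f j j<w vs a , g j j<w vs a
soundness ok ∀-∨     w ρ (f , g) j j<w vs (inj₁ b) = f j j<w vs b
soundness ok ∀-∨     w ρ (f , g) j j<w vs (inj₂ c) = g j j<w vs c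
soundness ok (∀-∃ {A = A} {B = B}) w ρ h j j<w vs (v , b) =
  sat-wk⁻ 1 A _ (ext vs ρ)
    (sat-cong (wk 1 A) (λ i → sym (ext₁-ext v vs ρ i))
      (h j j<w (cons v vs) (sat-cong B (ext₁-ext v vs ρ) b)))
soundness ok (∀-inst {k = k} {m = m} {A = A} {B = B} σ) w ρ h j j<w us a =
  sat-sub⁺ B (inst k m σ) (ext us ρ)
    (sat-cong B (λ i → sym (evalT-inst k m σ us ρ i))
      (h j j<w _ (sat-cong A (evalT-inst k m σ us ρ) (sat-sub⁻ A (inst k m σ) (ext us ρ) a))))
soundness ok eq-refl w ρ _ = refl
soundness ok (eq-subst {s = s} {t = t} {u = u} {v = v}) w ρ (s≡t , su≡sv) =
  eq-subst-valid s t u v ρ s≡t su≡sv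
soundness ok (cut d e)  w ρ a = soundness ok e w ρ (soundness ok d w ρ a)
soundness ok (∧-in d e) w ρ a = soundness ok d w ρ a , soundness ok e w ρ a
soundness ok (∨-el d e) w ρ (inj₁ a) = soundness ok d w ρ a
soundness ok (∨-el d e) w ρ (inj₂ b) = soundness ok e w ρ b
soundness ok (∃-el {B = B} d) w ρ (v , a) = sat-wk⁻ 1 B _ ρ (soundness ok d w (ext₁ v ρ) a)
soundness ok (∀-in {k = k} {A = A} d) w ρ a j j<w vs b =
  soundness ok d j (ext vs ρ) (sat-wk⁺ k A vs ρ (sat-persistent A j<w a) , b)
soundness ok (subst-rule {A = A} {B = B} σ d) w ρ a =
  sat-sub⁺ B σ ρ (soundness ok d w _ (sat-sub⁻ A σ ρ a))
soundness ok (ba-ax ax)       w ρ a = baAxiom-valid ax w ρ a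
soundness ok (ind-rule {A = A} d) w ρ a = sat-induction A (soundness ok d w) ρ a
soundness ok (extra ax)       w ρ a = ok ax w ρ a

BA-extraValid : ExtraValid BA
BA-extraValid ()

BA+U-extraValid : ExtraValid BA+U
BA+U-extraValid U w ρ = +-cancelʳ-≡ (ρ (suc (suc zero))) (ρ zero) (ρ (suc zero))

BAc-extraValid : ExtraValid BAc
BAc-extraValid monus₁ w ρ (inj₁ (v , x+Sv≡y)) =
  m≤n⇒m∸n≡0 (subst (ρ zero ≤_) x+Sv≡y (m≤m+n (ρ zero) (suc v)))
BAc-extraValid monus₁ w ρ (inj₂ x≡y) = trans (cong (ρ zero ∸_) (sym x≡y)) (n∸n≡0 (ρ zero))
BAc-extraValid monus₂ w ρ (inj₁ (v , y+Sv≡x)) =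
  +-∸-assoc 1 (subst (ρ (suc zero) ≤_) y+Sv≡x (m≤m+n (ρ (suc zero)) (suc v)))
BAc-extraValid monus₂ w ρ (inj₂ y≡x) = +-∸-assoc 1 (≤-reflexive y≡x)

positive-stable : ∀ {b n} {B : Formula b n} → Positive B →
                  ∀ {w w′} {ρ : Env n} → Sat B w ρ → Sat B w′ ρ
positive-stable (atom s t) p = p
positive-stable top        p = p
positive-stable bot        p = p
positive-stable (and a b)  (p , q) = positive-stable a p , positive-stable b q
positive-stable (or a b)   (inj₁ p) = inj₁ (positive-stable a p)
positive-stable (or a b)   (inj₂ q) = inj₂ (positive-stable b q)

posEx-stable : ∀ {b n} {B : Formula b n} → PosEx B →
               ∀ {w w′} {ρ : Env n} → Sat B w ρ → Sat B w′ ρ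
posEx-stable (matrix p) q = positive-stable p q
posEx-stable (ex p) (v , q) = v , posEx-stable p q

¬0≐0 : ∀ {b} → Formula b 0
¬0≐0 = (`0 ≐ `0) ⇛ ⊥'

¬0≐0-Σ₁ : ∀ {b} → Σ₁ (¬0≐0 {b})
¬0≐0-Σ₁ = bounded (imp (atom `0 `0) bot)

¬0≐0-not-posEx : ∀ {b} {B : Formula b 0} (ρ : Env 0) → PosEx B →
                 (Sat (¬0≐0 {b}) 0 ρ → Sat B 0 ρ) → (Sat B 1 ρ → Sat (¬0≐0 {b}) 1 ρ) → ⊥
¬0≐0-not-posEx ρ pe to from =
  from (posEx-stable pe (to λ _ ())) 0 (s≤s z≤n) (λ ()) refl

ρ∅ : Env 0
ρ∅ ()

¬MRDP : ∀ T → ExtraValid T → ¬ MRDP T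
¬MRDP T ok mrdp with mrdp ¬0≐0 ¬0≐0-Σ₁
... | _ , pe , A⇒B , B⇒A =
  ¬0≐0-not-posEx ρ∅ pe (soundness ok A⇒B 0 ρ∅) (soundness ok B⇒A 1 ρ∅)

¬MRDPʷ : ∀ T → ExtraValid T → ¬ MRDPʷ T
¬MRDPʷ T ok mrdp with mrdp ¬0≐0 ¬0≐0-Σ₁
... | _ , pe , ⊤⇒A⇔B with soundness ok ⊤⇒A⇔B 2 ρ∅ tt
...   | A→B , B→A =
  ¬0≐0-not-posEx (ext ρ∅ ρ∅) pe (A→B 0 (s≤s z≤n) ρ∅) (B→A 1 (s≤s (s≤s z≤n)) ρ∅)

corollary4p3 : ((¬ MRDPʷ BA) × (¬ MRDP BA))
               × ((¬ MRDPʷ BA+U) × (¬ MRDP BA+U))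
               × ((¬ MRDPʷ BAc) × (¬ MRDP BAc))
corollary4p3 = (¬MRDPʷ BA   BA-extraValid   , ¬MRDP BA   BA-extraValid)
             , (¬MRDPʷ BA+U BA+U-extraValid , ¬MRDP BA+U BA+U-extraValid)
             , (¬MRDPʷ BAc  BAc-extraValid  , ¬MRDP BAc  BAc-extraValid)
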